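{- For any sequence $\boldsymbol{\alpha}=(\alpha_1,\dots,\alpha_n)$ of nonnegative integers and any relation $U\subseteq X\times X$, $X=\{1,\dots,n\}$, \[\max_{w\in\mathcal{R}(\boldsymbol{\alpha})}\operatorname{maj}'_U w\ \ge\ \max_{w\in\mathcal{R}(\boldsymbol{\alpha})}\operatorname{inv}'_U w.\]
   Context: $\mathcal{R}(\boldsymbol{\alpha})$ is the set of words with exactly $\alpha_i$ occurrences of $i$ for each $i$. For a word $w=x_1\cdots x_m$: $\operatorname{inv}'_U w=\#\{(i,j):1\le i<j\le m,\ (x_i,x_j)\in U\}$ and $\operatorname{maj}'_U w=\sum i$ over $1\le i\le m-1$ with $(x_i,x_{i+1})\in U$. -}

module Defs where

open import Data.Nat using (ℕ; zero; suc; _+_)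
open import Data.Bool using (Bool; true; false; if_then_else_)
open import Data.Fin using (Fin)
open import Data.Fin.Properties using (_≟_)
open import Data.List using (List; []; _∷_; length; filter)
open import Relation.Binary.PropositionalEquality using (_≡_)

-- A relation U ⊆ X × X with X = {1,…,n} (here Fin n), given by its
-- characteristic function (every subset of a finite set is decidable).
Rel : ℕ → Set
Rel n = Fin n → Fin n → Bool

Word : ℕ → Set
Word n = List (Fin n)

occ : ∀ {n} → Fin n → Word n → ℕ
occ a w = length (filter (λ x → x ≟ a) w)

InR : ∀ {n} → (Fin n → ℕ) → Word n → Set
InR α w = ∀ i → occ i w ≡ α i

ind : ∀ {n} → Rel n → Fin n → Fin n → ℕ
ind U x y = if U x y then 1 else 0

countAfter : ∀ {n} → Rel n → Fin n → Word n → ℕ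
countAfter U x []       = 0
countAfter U x (y ∷ ys) = ind U x y + countAfter U x ys

-- inv'_U w = #{(i,j) : i < j, (x_i, x_j) ∈ U}
inv' : ∀ {n} → Rel n → Word n → ℕ
inv' U []       = 0
inv' U (x ∷ xs) = countAfter U x xs + inv' U xs

-- sum of positions i (1-based, the word starting at position k)
-- with (x_i, x_{i+1}) ∈ U
majFrom : ∀ {n} → Rel n → ℕ → Word n → ℕ
majFrom U k []             = 0
majFrom U k (x ∷ [])       = 0
majFrom U k (x ∷ y ∷ rest) =
  (if U x y then k else 0) + majFrom U (suc k) (y ∷ rest)

maj' : ∀ {n} → Rel n → Word n → ℕ
maj' U w = majFrom U 1 w

-- Insert the letters of w one at a time, last letter first.  A letter z put in
-- front of a word v contributes countAfter U z v to inv', so it suffices to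
-- insert z somewhere in v raising maj' by at least that much.  Inserting z
-- between letters x and y with (z, y) ∈ U creates a descent at that position and
-- shifts every later descent one place to the right.  Scanning v from the left,
-- either some such position pays for all letters y after it with (z, y) ∈ U, or
-- these letters are outnumbered by the descents, and then inserting z at the
-- very front works.
module Submission where

open import Defs
open import Data.Nat using (ℕ; _≤_; suc; _+_; z≤n; s≤s)
open import Data.Nat.Properties
  using (≤-refl; ≤-reflexive; ≤-trans; +-assoc; +-comm; +-suc; +-monoʳ-≤; +-monoˡ-≤; m≤n+m; module ≤-Reasoning)
open import Data.Nat.Tactic.RingSolver using (solve-∀)
open import Data.Nat.ListAction using (sum)
open import Data.Nat.ListAction.Properties using (sum-↭)
open import Data.Bool using (true; false; if_then_else_)
open import Data.Fin using (Fin)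
open import Data.Fin.Properties using (_≟_)
open import Data.List using ([]; _∷_; map)
open import Data.Product using (Σ; _×_; _,_)
open import Data.Sum using (_⊎_; inj₁; inj₂)
open import Relation.Binary.PropositionalEquality using (_≡_; refl; sym; trans; cong; module ≡-Reasoning)
open import Data.List.Relation.Binary.Permutation.Propositional
  using (_↭_; prep; swap; ↭-refl; ↭-sym; ↭-trans)
open import Data.List.Relation.Binary.Permutation.Propositional.Properties
  using (↭-length; filter-↭; map⁺)

occ-↭ : ∀ {n} (a : Fin n) {xs ys : Word n} → xs ↭ ys → occ a xs ≡ occ a ys
occ-↭ a p = ↭-length (filter-↭ (λ x → x ≟ a) p)

InR-↭ : ∀ {n} {α : Fin n → ℕ} {xs ys : Word n} → xs ↭ ys → InR α xs → InR α ys
InR-↭ p r i = trans (sym (occ-↭ i p)) (r i)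

module _ {n : ℕ} (U : Rel n) where

  ind≤1 : ∀ x y → ind U x y ≤ 1
  ind≤1 x y with U x y
  ... | true  = ≤-refl
  ... | false = z≤n

  countAfter≡sum : ∀ z ys → countAfter U z ys ≡ sum (map (ind U z) ys)
  countAfter≡sum z []       = refl
  countAfter≡sum z (y ∷ ys) = cong (ind U z y +_) (countAfter≡sum z ys)

  countAfter-↭ : ∀ z {xs ys} → xs ↭ ys → countAfter U z xs ≡ countAfter U z ys
  countAfter-↭ z {xs} {ys} p = begin
    countAfter U z xs           ≡⟨ countAfter≡sum z xs ⟩
    sum (map (ind U z) xs)      ≡⟨ sum-↭ (map⁺ (ind U z) p) ⟩
    sum (map (ind U z) ys)      ≡⟨ sym (countAfter≡sum z ys) ⟩
    countAfter U z ys           ∎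
    where open ≡-Reasoning

  des : Word n → ℕ
  des []          = 0
  des (x ∷ [])    = 0
  des (x ∷ y ∷ r) = ind U x y + des (y ∷ r)

  majFrom-suc : ∀ k w → majFrom U (suc k) w ≡ majFrom U k w + des w
  majFrom-suc k []          = refl
  majFrom-suc k (x ∷ [])    = refl
  majFrom-suc k (x ∷ y ∷ r) with U x y | majFrom-suc (suc k) (y ∷ r)
  ... | false | ih = ih
  ... | true  | ih = trans (cong (suc k +_) ih) (regroup k (majFrom U (suc k) (y ∷ r)) (des (y ∷ r)))
    where
    regroup : ∀ k m d → suc k + (m + d) ≡ k + m + (1 + d)
    regroup = solve-∀

  CanInsertAfter : ℕ → Fin n → Fin n → Word n → ℕ → Set
  CanInsertAfter k x z v g =
    Σ (Word n) λ v′ → v′ ↭ z ∷ v × majFrom U k (x ∷ v) + g ≤ majFrom U k (x ∷ v′)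

  CanInsertAfter-weaken : ∀ {k x z v g g′} → g ≤ g′ → CanInsertAfter k x z v g′ → CanInsertAfter k x z v g
  CanInsertAfter-weaken g≤g′ (v′ , p , gain) = v′ , p , ≤-trans (+-monoʳ-≤ _ g≤g′) gain

  CanInsertAfter-∷ : ∀ {k x y z u g} → CanInsertAfter (suc k) y z u g → CanInsertAfter k x z (y ∷ u) g
  CanInsertAfter-∷ {k} {x} {y} {z} {u} {g} (u′ , p , gain) =
    y ∷ u′ , ↭-trans (prep y p) (swap y z ↭-refl) , (begin
      (if U x y then k else 0) + majFrom U (suc k) (y ∷ u) + g   ≡⟨ +-assoc (if U x y then k else 0) _ g ⟩
      (if U x y then k else 0) + (majFrom U (suc k) (y ∷ u) + g) ≤⟨ +-monoʳ-≤ (if U x y then k else 0) gain ⟩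
      (if U x y then k else 0) + majFrom U (suc k) (y ∷ u′)      ∎)
    where open ≤-Reasoning

  insertBetween : ∀ k x z y u → U z y ≡ true →
                  (if U x y then k else 0) ≤ (if U x z then k else 0) →
                  CanInsertAfter k x z (y ∷ u) (suc k + des (y ∷ u))
  insertBetween k x z y u Uzy xy≤xz = z ∷ y ∷ u , ↭-refl , (begin
    a + m + (suc k + d)                   ≤⟨ +-monoˡ-≤ (suc k + d) (+-monoˡ-≤ m xy≤xz) ⟩
    b + m + (suc k + d)                   ≡⟨ regroup b m k d ⟩
    b + (suc k + (m + d))                 ≡⟨ cong (λ t → b + (suc k + t)) (sym (majFrom-suc (suc k) (y ∷ u))) ⟩
    b + (suc k + m′)                      ≡⟨ cong (λ t → b + ((if t then suc k else 0) + m′)) (sym Uzy) ⟩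
    b + ((if U z y then suc k else 0) + m′) ∎)
    where
    open ≤-Reasoning
    a = if U x y then k else 0
    b = if U x z then k else 0
    m = majFrom U (suc k) (y ∷ u)
    m′ = majFrom U (suc (suc k)) (y ∷ u)
    d = des (y ∷ u)
    regroup : ∀ b m k d → b + m + (suc k + d) ≡ b + (suc k + (m + d))
    regroup = solve-∀

  if-≤-or : ∀ a b k → (a ≡ true × b ≡ false) ⊎ (if a then k else 0) ≤ (if b then k else 0)
  if-≤-or true  false k = inj₁ (refl , refl)
  if-≤-or true  true  k = inj₂ ≤-refl
  if-≤-or false b     k = inj₂ z≤n

  insertAfter-or-descents : ∀ k x z v →
    CanInsertAfter k x z v (k + countAfter U z v) ⊎ countAfter U z v ≤ des (x ∷ v)
  insertAfter-or-descents k x z []      = inj₂ z≤n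
  insertAfter-or-descents k x z (y ∷ u) with insertAfter-or-descents (suc k) y z u
  ... | inj₁ ins = inj₁ (CanInsertAfter-weaken bound (CanInsertAfter-∷ ins))
    where
    bound : k + (ind U z y + countAfter U z u) ≤ suc k + countAfter U z u
    bound = ≤-trans (+-monoʳ-≤ k (+-monoˡ-≤ _ (ind≤1 z y))) (≤-reflexive (+-suc k _))
  ... | inj₂ few with U z y in Uzy | if-≤-or (U x y) (U x z) k
  ...   | false | _                = inj₂ (≤-trans few (m≤n+m _ _))
  ...   | true  | inj₁ (Uxy , _)   rewrite Uxy = inj₂ (s≤s few)
  ...   | true  | inj₂ xy≤xz       =
    inj₁ (CanInsertAfter-weaken (≤-trans (+-monoʳ-≤ k (s≤s few)) (≤-reflexive (+-suc k _)))
                                (insertBetween k x z y u Uzy xy≤xz))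

  -- A letter at position 0 contributes nothing, so inserting into a whole word
  -- is the case k = 0 of CanInsertAfter, behind an arbitrary first letter.
  majFrom-zero-∷ : ∀ x v → majFrom U 0 (x ∷ v) ≡ maj' U v
  majFrom-zero-∷ x []      = refl
  majFrom-zero-∷ x (y ∷ r) with U x y
  ... | true  = refl
  ... | false = refl

  insert-gain : ∀ z v → Σ (Word n) λ v′ → v′ ↭ z ∷ v × maj' U v + countAfter U z v ≤ maj' U v′
  insert-gain z v with insertAfter-or-descents 0 z z v
  ... | inj₁ (v′ , p , gain) = v′ , p , (begin
    maj' U v + countAfter U z v         ≡⟨ cong (_+ countAfter U z v) (majFrom-zero-∷ z v) ⟨
    majFrom U 0 (z ∷ v) + countAfter U z v ≤⟨ gain ⟩
    majFrom U 0 (z ∷ v′)                ≡⟨ majFrom-zero-∷ z v′ ⟩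
    maj' U v′                           ∎)
    where open ≤-Reasoning
  ... | inj₂ few = z ∷ v , ↭-refl , (begin
    maj' U v + countAfter U z v         ≤⟨ +-monoʳ-≤ (maj' U v) few ⟩
    maj' U v + des (z ∷ v)              ≡⟨ cong (_+ des (z ∷ v)) (majFrom-zero-∷ z v) ⟨
    majFrom U 0 (z ∷ v) + des (z ∷ v)   ≡⟨ majFrom-suc 0 (z ∷ v) ⟨
    maj' U (z ∷ v)                      ∎)
    where open ≤-Reasoning

  maj'-dominates-inv' : ∀ w → Σ (Word n) λ v → w ↭ v × inv' U w ≤ maj' U v
  maj'-dominates-inv' []       = [] , ↭-refl , z≤n
  maj'-dominates-inv' (z ∷ xs) with maj'-dominates-inv' xs
  ... | v , xs↭v , inv≤maj with insert-gain z v
  ...   | v′ , v′↭zv , gain = v′ , ↭-trans (prep z xs↭v) (↭-sym v′↭zv) , (begin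
    countAfter U z xs + inv' U xs  ≡⟨ cong (_+ inv' U xs) (countAfter-↭ z xs↭v) ⟩
    countAfter U z v + inv' U xs   ≤⟨ +-monoʳ-≤ (countAfter U z v) inv≤maj ⟩
    countAfter U z v + maj' U v    ≡⟨ +-comm (countAfter U z v) (maj' U v) ⟩
    maj' U v + countAfter U z v    ≤⟨ gain ⟩
    maj' U v′                      ∎)
    where open ≤-Reasoning

lemma3p2 : (n : ℕ) (α : Fin n → ℕ) (U : Rel n) →
           (w : Word n) → InR α w →
           Σ (Word n) (λ v → InR α v × inv' U w ≤ maj' U v)
lemma3p2 n α U w w∈R with maj'-dominates-inv' U w
... | v , w↭v , inv≤maj = v , InR-↭ w↭v w∈R , inv≤maj
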